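{- Let $k,d$ be positive integers, $c\ge 0$ an integer, and $a=c/k$. As $L'$ ranges over all subsets of $L$ of size $c$, the number of distinct configurations $F(L')$ is at most \[ (4a+1)^k\, d^{(4a+1)k}. \]
   Context: $\Phi=\{1,\dots,k\}$, $[d]=\{1,\dots,d\}$, $L=\{(\mu,j):\mu\in\Phi, j\in[d]\}$. For $L'\subseteq L$ with $|L'|=c$: $J_\mu=\{j\in[d]:(\mu,j)\in L'\}$ for $\mu\in\Phi$, $a=c/k$, light ground set $\Phi'=\{\mu\in\Phi:|J_\mu|\le 4a\}$, and the (solution) configuration of $L'$ is $F(L')=\{(\mu,j)\in L':\mu\in\Phi'\}$. -}

module Defs where

open import Data.Bool using (Bool; true; false; if_then_else_)
open import Data.Bool.Properties using () renaming (_≟_ to _≟ᵇ_)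
open import Data.Nat using (ℕ; zero; suc; _*_; _≤ᵇ_; _≟_)
open import Data.Fin.Subset using (Subset; ∣_∣; ⊥)
open import Data.List as List using (List; []; _∷_; concatMap; filter; deduplicate; length)
open import Data.Vec as Vec using (Vec; []; _∷_)
open import Data.Vec.Properties using (≡-dec)

-- A subset L' of L = Φ × [d] (Φ = Fin k) is represented by the family
-- (J_μ)_{μ ∈ Φ}: a vector of k subsets of [d] = Fin d, where the μ-th entry
-- is J_μ = { j : (μ , j) ∈ L' }.
Rel : ℕ → ℕ → Set
Rel k d = Vec (Subset d) k

size : ∀ {k d} → Rel k d → ℕ
size L' = Vec.sum (Vec.map ∣_∣ L')

allVecs : ∀ {A : Set} → List A → (n : ℕ) → List (Vec A n)
allVecs xs zero    = [] ∷ []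
allVecs xs (suc n) = concatMap (λ v → List.map (λ x → x ∷ v) xs) (allVecs xs n)

allSubsets : (d : ℕ) → List (Subset d)
allSubsets d = allVecs (true ∷ false ∷ []) d

allRels : (k d : ℕ) → List (Rel k d)
allRels k d = allVecs (allSubsets d) k

-- μ is light iff |J_μ| ≤ 4a = 4c/k, i.e. (for k > 0) k·|J_μ| ≤ 4c.
-- F(L') keeps the rows J_μ for light μ and empties the heavy rows.
config : (k c : ℕ) → ∀ {d} → Rel k d → Rel k d
config k c L' = Vec.map (λ J → if k * ∣ J ∣ ≤ᵇ 4 * c then J else ⊥) L'

configs : (k d c : ℕ) → List (Rel k d)
configs k d c =
  deduplicate (≡-dec (≡-dec _≟ᵇ_))
    (List.map (config k c) (filter (λ L' → size L' ≟ c) (allRels k d)))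

numConfigs : (k d c : ℕ) → ℕ
numConfigs k d c = length (configs k d c)

module Submission where

-- Every row of a configuration F(L') is either a light row J_μ, hence of size at
-- most m = ⌊4c/k⌋, or empty.  So the distinct configurations form a duplicate-free
-- list of k-tuples of subsets of [d] of size ≤ m; there are at most (m+1)·d^m such
-- subsets, hence at most ((m+1)·d^m)^k configurations, and multiplying by k^k,
-- ((m+1)·k)^k · d^(m·k) ≤ (4c+k)^k · d^(4c+k) because m·k ≤ 4c.

open import Defs
open import Data.Nat using (ℕ; zero; suc; _+_; _*_; _^_; _≤_; z≤n; s≤s; _≤ᵇ_; NonZero)
open import Data.Nat.Properties
open import Algebra.Properties.CommutativeSemigroup *-commutativeSemigroup using (xy∙z≈xz∙y; interchange)
open import Data.Nat.DivMod using (_/_; m*n/n≡m; /-monoˡ-≤; m/n*n≤m)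
open import Data.Bool using (true; false; if_then_else_; T)
open import Data.Bool.Properties using () renaming (_≟_ to _≟ᵇ_)
open import Data.Unit using (tt)
open import Data.Empty using (⊥-elim)
open import Data.List as List using (List; []; _∷_; length; concatMap; _++_)
open import Data.List.Properties using (length-++; length-map; length-removeAt′)
open import Data.List.Relation.Unary.Any using (here; there; index; _─_)
open import Data.List.Relation.Unary.All as All using ()
open import Data.List.Relation.Unary.AllPairs using (_∷_)
open import Data.List.Relation.Unary.Unique.Propositional using (Unique)
open import Data.List.Relation.Unary.Unique.DecPropositional.Properties using (deduplicate-!)
open import Data.List.Relation.Binary.Subset.Propositional using (_⊆_)
open import Data.List.Membership.Propositional using (_∈_; lose)
open import Data.List.Membership.Propositional.Properties
  using (∈-map⁺; ∈-map⁻; ∈-++⁺ˡ; ∈-++⁺ʳ; ∈-concatMap⁺; ∈-deduplicate⁻)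
open import Data.Vec using (Vec; []; _∷_)
open import Data.Vec.Properties using (≡-dec)
open import Data.Vec.Relation.Unary.All as VAll using () renaming (All to VAll)
open import Data.Vec.Relation.Unary.All.Properties using () renaming (map⁺ to VAll-map⁺)
open import Data.Fin.Subset using (Subset; ∣_∣; ⊥; inside; outside)
open import Data.Fin.Subset.Properties using (∣⊥∣≡0)
open import Data.Product using (_,_)
open import Relation.Binary.Definitions using (DecidableEquality)
open import Relation.Binary.PropositionalEquality

^-distribʳ-* : ∀ m n o → (m * n) ^ o ≡ m ^ o * n ^ o
^-distribʳ-* m n zero    = refl
^-distribʳ-* m n (suc o) = begin
  m * n * (m * n) ^ o     ≡⟨ cong (m * n *_) (^-distribʳ-* m n o) ⟩
  m * n * (m ^ o * n ^ o) ≡⟨ interchange m n (m ^ o) (n ^ o) ⟩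
  m ^ suc o * n ^ suc o   ∎
  where open ≡-Reasoning

*≤⇒≤/ : ∀ k x n .{{_ : NonZero k}} → k * x ≤ n → x ≤ n / k
*≤⇒≤/ k x n kx≤n = subst (_≤ n / k) (m*n/n≡m x k) (/-monoˡ-≤ k (subst (_≤ n) (*-comm k x) kx≤n))

module _ {A : Set} where

  ∈-─⁺ : ∀ {x z} {ys : List A} (x∈ys : x ∈ ys) → z ∈ ys → x ≢ z → z ∈ (ys ─ x∈ys)
  ∈-─⁺ (here refl)   (here refl)  x≢z = ⊥-elim (x≢z refl)
  ∈-─⁺ (here refl)   (there z∈ys) _   = z∈ys
  ∈-─⁺ (there _)     (here refl)  _   = here refl
  ∈-─⁺ (there x∈ys)  (there z∈ys) x≢z = there (∈-─⁺ x∈ys z∈ys x≢z)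

  ⊆-Unique⇒length-≤ : ∀ {xs ys : List A} → Unique xs → xs ⊆ ys → length xs ≤ length ys
  ⊆-Unique⇒length-≤ {[]}     _            _     = z≤n
  ⊆-Unique⇒length-≤ {x ∷ xs} {ys} (x∉xs ∷ xs!) xs⊆ys = begin
    suc (length xs)          ≤⟨ s≤s (⊆-Unique⇒length-≤ xs! xs⊆ys─x) ⟩
    suc (length (ys ─ x∈ys)) ≡⟨ length-removeAt′ ys (index x∈ys) ⟨
    length ys                ∎
    where
    open ≤-Reasoning
    x∈ys : x ∈ ys
    x∈ys = xs⊆ys (here refl)
    xs⊆ys─x : xs ⊆ (ys ─ x∈ys)
    xs⊆ys─x z∈xs = ∈-─⁺ x∈ys (xs⊆ys (there z∈xs)) (All.lookup x∉xs z∈xs)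

length-concatMap-const : ∀ {B C : Set} (f : B → List C) {n} →
  (∀ b → length (f b) ≡ n) → ∀ bs → length (concatMap f bs) ≡ length bs * n
length-concatMap-const f _     []       = refl
length-concatMap-const f ∣f∣≡n (b ∷ bs) =
  trans (length-++ (f b)) (cong₂ _+_ (∣f∣≡n b) (length-concatMap-const f ∣f∣≡n bs))

module _ {A : Set} where

  length-allVecs : ∀ (xs : List A) n → length (allVecs xs n) ≡ length xs ^ n
  length-allVecs xs zero    = refl
  length-allVecs xs (suc n) = begin
    length (allVecs xs (suc n))  ≡⟨ length-concatMap-const _ (λ v → length-map (_∷ v) xs) (allVecs xs n) ⟩
    length (allVecs xs n) * ∣xs∣ ≡⟨ cong (_* ∣xs∣) (length-allVecs xs n) ⟩
    ∣xs∣ ^ n * ∣xs∣              ≡⟨ *-comm (∣xs∣ ^ n) ∣xs∣ ⟩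
    ∣xs∣ ^ suc n                 ∎
    where
    open ≡-Reasoning
    ∣xs∣ : ℕ
    ∣xs∣ = length xs

  ∈-allVecs : ∀ {xs : List A} {n} {v : Vec A n} → VAll (_∈ xs) v → v ∈ allVecs xs n
  ∈-allVecs VAll.[] = here refl
  ∈-allVecs {xs} (x∈xs VAll.∷ v∈) = ∈-concatMap⁺ _ (lose (∈-allVecs v∈) (∈-map⁺ _ x∈xs))

smallSubsets : (d m : ℕ) → List (Subset d)
smallSubsets zero    m       = [] ∷ []
smallSubsets (suc d) zero    = List.map (outside ∷_) (smallSubsets d zero)
smallSubsets (suc d) (suc m) =
  List.map (inside ∷_) (smallSubsets d m) ++ List.map (outside ∷_) (smallSubsets d (suc m))

∈-smallSubsets : ∀ {d m} (J : Subset d) → ∣ J ∣ ≤ m → J ∈ smallSubsets d m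
∈-smallSubsets {zero}          []            _         = here refl
∈-smallSubsets {suc d} {zero}  (outside ∷ J) ∣J∣≤0     = ∈-map⁺ _ (∈-smallSubsets J ∣J∣≤0)
∈-smallSubsets {suc d} {suc m} (inside ∷ J)  (s≤s ∣J∣≤m) = ∈-++⁺ˡ (∈-map⁺ _ (∈-smallSubsets J ∣J∣≤m))
∈-smallSubsets {suc d} {suc m} (outside ∷ J) ∣J∣≤1+m   =
  ∈-++⁺ʳ _ (∈-map⁺ _ (∈-smallSubsets J ∣J∣≤1+m))

length-smallSubsets-0 : ∀ d → length (smallSubsets d 0) ≡ 1
length-smallSubsets-0 zero    = refl
length-smallSubsets-0 (suc d) = trans (length-map (outside ∷_) (smallSubsets d 0)) (length-smallSubsets-0 d)

length-smallSubsets-suc : ∀ d m → length (smallSubsets (suc d) (suc m))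
  ≡ length (smallSubsets d m) + length (smallSubsets d (suc m))
length-smallSubsets-suc d m = begin
  length (List.map (inside ∷_) (smallSubsets d m) ++ List.map (outside ∷_) (smallSubsets d (suc m)))
    ≡⟨ length-++ (List.map (inside ∷_) (smallSubsets d m)) ⟩
  length (List.map (inside ∷_) (smallSubsets d m)) + length (List.map (outside ∷_) (smallSubsets d (suc m)))
    ≡⟨ cong₂ _+_ (length-map _ (smallSubsets d m)) (length-map _ (smallSubsets d (suc m))) ⟩
  length (smallSubsets d m) + length (smallSubsets d (suc m)) ∎
  where open ≡-Reasoning

-- The bound needs d ≥ 1: for d = 0 there is one subset but (m + 1) · 0 ^ m = 0.
length-smallSubsets-≤ : ∀ e m → length (smallSubsets (suc e) m) ≤ suc m * suc e ^ m
length-smallSubsets-≤ e       zero    = ≤-reflexive (length-smallSubsets-0 (suc e))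
length-smallSubsets-≤ zero    (suc m) = begin
  2                       ≤⟨ s≤s (s≤s z≤n) ⟩
  suc (suc m)             ≡⟨ *-identityʳ (suc (suc m)) ⟨
  suc (suc m) * 1         ≡⟨ cong (suc (suc m) *_) (^-zeroˡ (suc m)) ⟨
  suc (suc m) * 1 ^ suc m ∎
  where open ≤-Reasoning
length-smallSubsets-≤ (suc e) (suc m) = begin
  length (smallSubsets (suc d) (suc m))
    ≡⟨ length-smallSubsets-suc d m ⟩
  length (smallSubsets d m) + length (smallSubsets d (suc m))
    ≤⟨ +-mono-≤ (length-smallSubsets-≤ e m) (length-smallSubsets-≤ e (suc m)) ⟩
  suc m * d ^ m + suc (suc m) * (d * d ^ m)
    ≤⟨ +-monoˡ-≤ _ (*-monoˡ-≤ (d ^ m) (n≤1+n (suc m))) ⟩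
  suc (suc m) * d ^ m + suc (suc m) * (d * d ^ m)
    ≡⟨ *-distribˡ-+ (suc (suc m)) (d ^ m) (d * d ^ m) ⟨
  suc (suc m) * (suc d * d ^ m)
    ≤⟨ *-monoʳ-≤ (suc (suc m)) (*-monoʳ-≤ (suc d) (^-monoˡ-≤ m (n≤1+n d))) ⟩
  suc (suc m) * (suc d * suc d ^ m) ∎
  where
  open ≤-Reasoning
  d : ℕ
  d = suc e

row-∈-smallSubsets : ∀ k n {d} .{{_ : NonZero k}} (J : Subset d) →
  (if k * ∣ J ∣ ≤ᵇ n then J else ⊥) ∈ smallSubsets d (n / k)
row-∈-smallSubsets k n {d} J with k * ∣ J ∣ ≤ᵇ n in light
... | true  = ∈-smallSubsets J (*≤⇒≤/ k ∣ J ∣ n (≤ᵇ⇒≤ (k * ∣ J ∣) n (subst T (sym light) tt)))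
... | false = ∈-smallSubsets ⊥ (subst (_≤ n / k) (sym (∣⊥∣≡0 d)) z≤n)

numConfigs-≤ : ∀ k d c .{{_ : NonZero k}} →
  numConfigs k d c ≤ length (smallSubsets d (4 * c / k)) ^ k
numConfigs-≤ k d c = begin
  numConfigs k d c                     ≤⟨ ⊆-Unique⇒length-≤ (deduplicate-! _≟ᴿ_ _) configs⊆ ⟩
  length (allVecs (smallSubsets d m) k) ≡⟨ length-allVecs (smallSubsets d m) k ⟩
  length (smallSubsets d m) ^ k        ∎
  where
  open ≤-Reasoning
  m : ℕ
  m = 4 * c / k
  _≟ᴿ_ : DecidableEquality (Rel k d)
  _≟ᴿ_ = ≡-dec (≡-dec _≟ᵇ_)
  configs⊆ : configs k d c ⊆ allVecs (smallSubsets d m) k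
  configs⊆ F∈ with ∈-map⁻ (config k c) (∈-deduplicate⁻ _≟ᴿ_ _ F∈)
  ... | L' , _ , refl = ∈-allVecs (VAll-map⁺ (VAll.universal (row-∈-smallSubsets k (4 * c)) L'))

lemma5 : (k d c : ℕ) → 1 ≤ k → 1 ≤ d →
    numConfigs k d c * k ^ k ≤ (4 * c + k) ^ k * d ^ (4 * c + k)
lemma5 k@(suc _) d@(suc e) c _ _ = begin
  numConfigs k d c * k ^ k
    ≤⟨ *-monoˡ-≤ (k ^ k) (≤-trans (numConfigs-≤ k d c) (^-monoˡ-≤ k (length-smallSubsets-≤ e m))) ⟩
  (suc m * d ^ m) ^ k * k ^ k
    ≡⟨ cong (_* k ^ k) (^-distribʳ-* (suc m) (d ^ m) k) ⟩
  suc m ^ k * (d ^ m) ^ k * k ^ k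
    ≡⟨ xy∙z≈xz∙y (suc m ^ k) ((d ^ m) ^ k) (k ^ k) ⟩
  suc m ^ k * k ^ k * (d ^ m) ^ k
    ≡⟨ cong₂ _*_ (^-distribʳ-* (suc m) k k) (sym (^-*-assoc d m k)) ⟨
  (suc m * k) ^ k * d ^ (m * k)
    ≤⟨ *-mono-≤ (^-monoˡ-≤ k (+-monoʳ-≤ k mk≤4c)) (^-monoʳ-≤ d (≤-trans mk≤4c (m≤m+n (4 * c) k))) ⟩
  (k + 4 * c) ^ k * d ^ (4 * c + k)
    ≡⟨ cong (λ x → x ^ k * d ^ (4 * c + k)) (+-comm k (4 * c)) ⟩
  (4 * c + k) ^ k * d ^ (4 * c + k) ∎
  where
  open ≤-Reasoning
  m : ℕ
  m = 4 * c / k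
  mk≤4c : m * k ≤ 4 * c
  mk≤4c = m/n*n≤m (4 * c) k
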